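{- Let $\mathbb{G}=(V,E,T)$ be a temporal graph and $\Delta\in\mathbb{N}$. In each (recursive) call of the procedure $\textsc{BronKerboschDelta}$ described in the context, started with the initial call $P=\{(v,T)\mid v\in V\}$, $R=(\emptyset,T)$, $X=\emptyset$, the argument $R=(C,I)$ is a time-maximal $\Delta$-clique of $\mathbb{G}$.
   Context: A temporal graph $\mathbb{G}=(V,E,T)$ consists of a finite vertex set $V$, an integer time interval $T=[\alpha,\omega]$, and a set of time-edges $E\subseteq\binom{V}{2}\times T$. All intervals are intervals of integers; for an interval $J=[a,b]$ write $|J|=b-a$. A $\Delta$-clique is a tuple $(C,I=[a,b])$ with $C\subseteq V$, $b-a\ge\Delta$, $I\subseteq T$, such that for all $\tau\in[a,b-\Delta]$ and all distinct $v,w\in C$ there is $(\{v,w\},t)\in E$ with $t\in[\tau,\tau+\Delta]$. A $\Delta$-clique $(C,I)$ is time-maximal if there is no $\Delta$-clique $(C',I')$ with $I\subsetneq I'$ and $C\subseteq C'$. A vertex-interval pair is a tuple $(v,I)$ with $v\in V$, $I\subseteq T$ an interval. $\Delta$-neighborhood: $N^{\Delta}(v,I)$ is the set of all $(w,I'=[a',b'])$ such that $b'-a'\ge\Delta$, $I'\subseteq I$, for every $\tau\in[a',b'-\Delta]$ there is $(\{v,w\},t)\in E$ with $t\in[\tau,\tau+\Delta]$, and $I'$ is inclusion-maximal among subintervals of $I$ with these properties. $\Delta$-cut: $Y\sqcap Z=\{(v,I\cap I')\mid (v,I)\in Y,\ (v,I')\in Z,\ |I\cap I'|\ge\Delta\}$.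 Procedure $\textsc{BronKerboschDelta}(P,R=(C,I),X)$: (1) if every $(w,I')\in P\cup X$ satisfies $I'\subsetneq I$, add $R$ to the solution; (2) for each $(v,I')\in P$ (iterating over the current $P$): set $R'=(C\cup\{v\},I')$, $P'=P\sqcap N^{\Delta}(v,I')$, $X'=X\sqcap N^{\Delta}(v,I')$, call $\textsc{BronKerboschDelta}(P',R',X')$, then remove $(v,I')$ from $P$ and add it to $X$. -}

module Defs where

open import Data.Nat using (ℕ)
open import Data.Integer using (ℤ; +_; _+_; _-_; _≤_; _⊔_; _⊓_)
open import Data.Fin using (Fin)
open import Data.List using (List)
open import Data.List.Membership.Propositional using (_∈_)
open import Data.Product using (_×_; _,_; Σ; ∃; ∃-syntax)
open import Data.Sum using (_⊎_)
open import Data.Empty using (⊥)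
open import Relation.Nullary using (¬_)
open import Relation.Binary.PropositionalEquality using (_≡_; _≢_)
open import Level using (Level) renaming (suc to lsuc; zero to lzero)

record Interval : Set where
  constructor [_,_]
  field
    lo : ℤ
    hi : ℤ
open Interval public

∣_∣ᵢ : Interval → ℤ
∣ J ∣ᵢ = hi J - lo J

_∈ᵢ_ : ℤ → Interval → Set
t ∈ᵢ J = lo J ≤ t × t ≤ hi J

-- inclusion of intervals (as sets of integers; all intervals used are nonempty)
_⊆ᵢ_ : Interval → Interval → Set
I ⊆ᵢ J = lo J ≤ lo I × hi I ≤ hi J

_⊊ᵢ_ : Interval → Interval → Set
I ⊊ᵢ J = I ⊆ᵢ J × I ≢ J

_∩ᵢ_ : Interval → Interval → Interval
I ∩ᵢ J = [ lo I ⊔ lo J , hi I ⊓ hi J ]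

-- Temporal graphs: V = Fin n, T = [α, ω], E a (finite) set of time-edges.
-- A time-edge ({u,v},t) is stored as a triple (u , v , t) with u ≢ v, t ∈ T.

record TemporalGraph : Set where
  field
    n     : ℕ
    T     : Interval
    edges : List (Fin n × Fin n × ℤ)
    edges-wf : ∀ {u v t} → (u , v , t) ∈ edges → u ≢ v × t ∈ᵢ T
open TemporalGraph public

module _ (G : TemporalGraph) (Δ : ℕ) where

  V : Set
  V = Fin (n G)

  -- ({v,w},t) ∈ E  (unordered pair)
  Edge : V → V → ℤ → Set
  Edge v w t = ((v , w , t) ∈ edges G) ⊎ ((w , v , t) ∈ edges G)

  Covered : V → V → Interval → Set
  Covered v w J = ∀ τ → lo J ≤ τ → τ ≤ hi J - + Δ →
                  ∃[ t ] (τ ≤ t × t ≤ τ + + Δ × Edge v w t)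

  VSet : Set₁
  VSet = V → Set

  IsΔClique : VSet → Interval → Set
  IsΔClique C I =
    (+ Δ ≤ ∣ I ∣ᵢ) × (I ⊆ᵢ T G) ×
    (∀ v w → C v → C w → v ≢ w → Covered v w I)

  IsTimeMaximalΔClique : VSet → Interval → Set₁
  IsTimeMaximalΔClique C I =
    IsΔClique C I ×
    (¬ (Σ VSet λ C' → Σ Interval λ I' →
          IsΔClique C' I' × I ⊊ᵢ I' × (∀ v → C v → C' v)))

  VI : Set
  VI = V × Interval

  VISet : Set₁
  VISet = VI → Set

  NbrProp : V → V → Interval → Set
  NbrProp v w J = (+ Δ ≤ ∣ J ∣ᵢ) × Covered v w J

  NΔ : V → Interval → VISet
  NΔ v I (w , I') =
    I' ⊆ᵢ I × NbrProp v w I' ×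
    (∀ J → I' ⊆ᵢ J → J ⊆ᵢ I → NbrProp v w J → J ⊆ᵢ I')

  _⊓Δ_ : VISet → VISet → VISet
  (Y ⊓Δ Z) (v , K) =
    ∃[ I ] ∃[ I' ] (Y (v , I) × Z (v , I') × K ≡ (I ∩ᵢ I') × + Δ ≤ ∣ I ∩ᵢ I' ∣ᵢ)

  P₀ : VISet
  P₀ (v , I) = I ≡ T G

  ∅ᵥ : VSet
  ∅ᵥ _ = ⊥

  ∅ₓ : VISet
  ∅ₓ _ = ⊥

  -- Calls of BronKerboschDelta (P, R = (C, I), X) made during the run started
  -- with the initial call.  In a call (P, R, X), the loop processes the elements
  -- of P in some order; when processing p = (v, I'), the set S of already
  -- processed elements has been moved from P to X.  Since the order is
  -- arbitrary, S ranges over all subsets of P not containing p.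
  data Call : VISet → VSet → Interval → VISet → Set₁ where
    initial : Call P₀ ∅ᵥ (T G) ∅ₓ
    recurse : ∀ {P C I X} → Call P C I X →
              (S : VISet) → (∀ q → S q → P q) →
              (v : V) (I' : Interval) → P (v , I') → ¬ S (v , I') →
              let P₁ : VISet
                  P₁ q = P q × ¬ S q
                  X₁ : VISet
                  X₁ q = X q ⊎ S q
                  C' : VSet
                  C' w = C w ⊎ w ≡ v
              in Call (P₁ ⊓Δ NΔ v I') C' I' (X₁ ⊓Δ NΔ v I')

-- In every call (P, (C, I), X), each (w, J) ∈ P makes (C ∪ {w}, J) a Δ-clique with
-- J inclusion-maximal among the intervals of Δ-cliques on C ∪ {w}.  This survives the
-- Δ-cut with N^Δ(v, I') because Δ-cliques on one vertex set whose intervals overlap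
-- in at least Δ glue to a Δ-clique on the hull, so a maximal interval contains every
-- clique interval overlapping it that much.  The argument R = (C ∪ {v}, I') of a
-- recursive call comes from (v, I') ∈ P, and maximality of the interval alone already
-- gives time-maximality, since Δ-cliques stay Δ-cliques on fewer vertices.
module Submission where

open import Defs
open import Data.Nat using (ℕ)
open import Data.Integer using (ℤ; +_; -_; _+_; _-_; _≤_; _⊔_; _⊓_; 0ℤ)
open import Data.Integer.Properties
open import Data.Product using (_×_; _,_; proj₁; proj₂)
open import Data.Sum using (_⊎_; inj₁; inj₂) renaming (swap to ⊎-swap)
open import Data.Empty using (⊥-elim)
open import Function using (_∘_)
open import Relation.Nullary using (¬_; yes; no; contradiction)
open import Relation.Binary.PropositionalEquality
  using (_≡_; _≢_; refl; sym; trans; cong; cong₂; subst)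

private variable
  i j k t : ℤ
  I J K : Interval

⊆ᵢ-refl : I ⊆ᵢ I
⊆ᵢ-refl = ≤-refl , ≤-refl

⊆ᵢ-trans : I ⊆ᵢ J → J ⊆ᵢ K → I ⊆ᵢ K
⊆ᵢ-trans (a , b) (c , d) = ≤-trans c a , ≤-trans b d

⊆ᵢ-antisym : I ⊆ᵢ J → J ⊆ᵢ I → I ≡ J
⊆ᵢ-antisym (a , b) (c , d) = cong₂ [_,_] (≤-antisym c a) (≤-antisym b d)

∣∣ᵢ-mono-⊆ᵢ : I ⊆ᵢ J → ∣ I ∣ᵢ ≤ ∣ J ∣ᵢ
∣∣ᵢ-mono-⊆ᵢ (a , b) = +-mono-≤ b (neg-mono-≤ a)

-- the interval hull, which is the union whenever the two intervals overlap
_∪ᵢ_ : Interval → Interval → Interval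
I ∪ᵢ J = [ lo I ⊓ lo J , hi I ⊔ hi J ]

∪ᵢ-upperˡ : ∀ I J → I ⊆ᵢ (I ∪ᵢ J)
∪ᵢ-upperˡ _ _ = i⊓j≤i _ _ , i≤i⊔j _ _

∪ᵢ-upperʳ : ∀ I J → J ⊆ᵢ (I ∪ᵢ J)
∪ᵢ-upperʳ I _ = i⊓j≤j (lo I) _ , i≤j⊔i (hi I) _

∪ᵢ-least : I ⊆ᵢ K → J ⊆ᵢ K → (I ∪ᵢ J) ⊆ᵢ K
∪ᵢ-least (a , b) (c , d) = ⊓-glb a c , ⊔-lub b d

∩ᵢ-lowerˡ : ∀ I J → (I ∩ᵢ J) ⊆ᵢ I
∩ᵢ-lowerˡ _ _ = i≤i⊔j _ _ , i⊓j≤i _ _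

∩ᵢ-lowerʳ : ∀ I J → (I ∩ᵢ J) ⊆ᵢ J
∩ᵢ-lowerʳ I _ = i≤j⊔i (lo I) _ , i⊓j≤j (hi I) _

∩ᵢ-greatest : K ⊆ᵢ I → K ⊆ᵢ J → K ⊆ᵢ (I ∩ᵢ J)
∩ᵢ-greatest (a , b) (c , d) = ⊔-lub a c , ⊓-glb b d

i⊓j≤k⇒i≰k⇒j≤k : i ⊓ j ≤ k → ¬ i ≤ k → j ≤ k
i⊓j≤k⇒i≰k⇒j≤k {i} {j} p i≰k with ⊓-sel i j
... | inj₁ i⊓j≡i = contradiction (subst (_≤ _) i⊓j≡i p) i≰k
... | inj₂ i⊓j≡j = subst (_≤ _) i⊓j≡j p

k≤i⊔j⇒k≰i⇒k≤j : k ≤ i ⊔ j → ¬ k ≤ i → k ≤ j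
k≤i⊔j⇒k≰i⇒k≤j {i = i} {j} p k≰i with ⊔-sel i j
... | inj₁ i⊔j≡i = contradiction (subst (_ ≤_) i⊔j≡i p) k≰i
... | inj₂ i⊔j≡j = subst (_ ≤_) i⊔j≡j p

∈ᵢ-∪ᵢ : lo (I ∩ᵢ J) ≤ hi (I ∩ᵢ J) → t ∈ᵢ (I ∪ᵢ J) → t ∈ᵢ I ⊎ t ∈ᵢ J
∈ᵢ-∪ᵢ {I} {J} {t} meet (p , q) with lo I ≤? t | t ≤? hi I
... | yes lo≤t | yes t≤hi = inj₁ (lo≤t , t≤hi)
... | no lo≰t  | _        = inj₂ (i⊓j≤k⇒i≰k⇒j≤k p lo≰t , t≤hi)
  where
  t≤hi : t ≤ hi J
  t≤hi = ≤-trans (<⇒≤ (≰⇒> lo≰t))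
             (≤-trans (i≤i⊔j _ (lo J)) (≤-trans meet (i⊓j≤j (hi I) _)))
... | yes _    | no t≰hi  = inj₂ (lo≤t , k≤i⊔j⇒k≰i⇒k≤j q t≰hi)
  where
  lo≤t : lo J ≤ t
  lo≤t = ≤-trans (i≤j⊔i (lo I) _)
           (≤-trans meet (≤-trans (i⊓j≤i _ (hi J)) (<⇒≤ (≰⇒> t≰hi))))

long-∩ᵢ : ∀ I J → k ≤ ∣ K ∣ᵢ → K ⊆ᵢ I → K ⊆ᵢ J → k ≤ ∣ I ∩ᵢ J ∣ᵢ
long-∩ᵢ _ _ long K⊆I K⊆J = ≤-trans long (∣∣ᵢ-mono-⊆ᵢ (∩ᵢ-greatest K⊆I K⊆J))

k≤j-i⇒i≤j-k : k ≤ j - i → i ≤ j - k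
k≤j-i⇒i≤j-k {k} {j} {i} p = 0≤i-j⇒j≤i (subst (0ℤ ≤_) swap (i≤j⇒0≤j-i p))
  where
  swap : (j - i) - k ≡ (j - k) - i
  swap = trans (+-assoc j (- i) (- k))
           (trans (cong (λ x → j + x) (+-comm (- i) (- k))) (sym (+-assoc j (- k) (- i))))

module _ (G : TemporalGraph) (Δ : ℕ) where

  private variable
    v w : V G Δ
    C D : VSet G Δ
    P X : VISet G Δ
    L : Interval

  -- the start times τ quantified over in Covered
  window : Interval → Interval
  window J = [ lo J , hi J - + Δ ]

  window-∪ᵢ : ∀ I J → window (I ∪ᵢ J) ⊆ᵢ (window I ∪ᵢ window J)
  window-∪ᵢ I J =
    ≤-refl , ≤-reflexive (mono-≤-distrib-⊔ (+-monoˡ-≤ (- + Δ)) (hi I) (hi J))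

  window-∩ᵢ-nonempty : ∀ I J → + Δ ≤ ∣ I ∩ᵢ J ∣ᵢ →
                       lo (window I ∩ᵢ window J) ≤ hi (window I ∩ᵢ window J)
  window-∩ᵢ-nonempty I J ov = ≤-trans (k≤j-i⇒i≤j-k {j = hi I ⊓ hi J} ov)
    (≤-reflexive (mono-≤-distrib-⊓ (+-monoˡ-≤ (- + Δ)) (hi I) (hi J)))

  Covered-⊆ᵢ : J ⊆ᵢ L → Covered G Δ v w L → Covered G Δ v w J
  Covered-⊆ᵢ (a , b) cov τ p q = cov τ (≤-trans a p) (≤-trans q (+-monoˡ-≤ (- + Δ) b))

  Covered-sym : Covered G Δ v w J → Covered G Δ w v J
  Covered-sym cov τ p q with cov τ p q
  ... | t , τ≤t , t≤τ+Δ , e = t , τ≤t , t≤τ+Δ , ⊎-swap e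

  Covered-∪ᵢ : + Δ ≤ ∣ I ∩ᵢ J ∣ᵢ →
               Covered G Δ v w I → Covered G Δ v w J → Covered G Δ v w (I ∪ᵢ J)
  Covered-∪ᵢ {I} {J} ov covI covJ τ p q
    with ∈ᵢ-∪ᵢ {window I} {window J}
           (window-∩ᵢ-nonempty I J ov) (p , ≤-trans q (proj₂ (window-∪ᵢ I J)))
  ... | inj₁ (p′ , q′) = covI τ p′ q′
  ... | inj₂ (p′ , q′) = covJ τ p′ q′

  ¬Covered-self : + Δ ≤ ∣ J ∣ᵢ → ¬ Covered G Δ v v J
  ¬Covered-self {J} long cov with cov (lo J) ≤-refl (k≤j-i⇒i≤j-k {j = hi J} long)
  ... | _ , _ , _ , inj₁ e = proj₁ (edges-wf G e) refl
  ... | _ , _ , _ , inj₂ e = proj₁ (edges-wf G e) refl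

  _∷ᶜ_ : VSet G Δ → V G Δ → VSet G Δ
  (C ∷ᶜ v) u = C u ⊎ u ≡ v

  IsΔClique-⊆ : (∀ u → C u → D u) → IsΔClique G Δ D J → IsΔClique G Δ C J
  IsΔClique-⊆ C⊆D (long , inT , cov) =
    long , inT , λ x y cx cy x≢y → cov x y (C⊆D x cx) (C⊆D y cy) x≢y

  IsΔClique-⊆ᵢ : + Δ ≤ ∣ J ∣ᵢ → J ⊆ᵢ L → IsΔClique G Δ C L → IsΔClique G Δ C J
  IsΔClique-⊆ᵢ long J⊆L (_ , inT , cov) =
    long , ⊆ᵢ-trans J⊆L inT , λ x y cx cy x≢y → Covered-⊆ᵢ J⊆L (cov x y cx cy x≢y)

  IsΔClique-∪ᵢ : + Δ ≤ ∣ I ∩ᵢ J ∣ᵢ →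
                 IsΔClique G Δ C I → IsΔClique G Δ C J → IsΔClique G Δ C (I ∪ᵢ J)
  IsΔClique-∪ᵢ {I} {J} ov (longI , inTI , covI) (_ , inTJ , covJ) =
    ≤-trans longI (∣∣ᵢ-mono-⊆ᵢ (∪ᵢ-upperˡ I J)) , ∪ᵢ-least inTI inTJ ,
    λ x y cx cy x≢y → Covered-∪ᵢ {I} {J} ov (covI x y cx cy x≢y) (covJ x y cx cy x≢y)

  IsΔClique-∷ᶜ-∷ᶜ : IsΔClique G Δ (C ∷ᶜ v) J → IsΔClique G Δ (C ∷ᶜ w) J →
                    Covered G Δ v w J → IsΔClique G Δ ((C ∷ᶜ v) ∷ᶜ w) J
  IsΔClique-∷ᶜ-∷ᶜ {C} {v} {J} {w} (long , inT , covv) (_ , _ , covw) covvw =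
    long , inT , pairs
    where
    pairs : ∀ x y → ((C ∷ᶜ v) ∷ᶜ w) x → ((C ∷ᶜ v) ∷ᶜ w) y → x ≢ y → Covered G Δ x y J
    pairs x y (inj₁ cx)          (inj₁ cy)          x≢y = covv x y cx cy x≢y
    pairs x y (inj₁ (inj₁ cx))   (inj₂ refl)        x≢y = covw x y (inj₁ cx) (inj₂ refl) x≢y
    pairs x y (inj₁ (inj₂ refl)) (inj₂ refl)        _   = covvw
    pairs x y (inj₂ refl)        (inj₁ (inj₁ cy))   x≢y = covw x y (inj₂ refl) (inj₁ cy) x≢y
    pairs x y (inj₂ refl)        (inj₁ (inj₂ refl)) _   = Covered-sym {J = J} covvw
    pairs x y (inj₂ refl)        (inj₂ refl)        x≢y = ⊥-elim (x≢y refl)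

  IsIntervalMaximalΔClique : VSet G Δ → Interval → Set
  IsIntervalMaximalΔClique C J =
    IsΔClique G Δ C J × (∀ L → J ⊆ᵢ L → IsΔClique G Δ C L → L ⊆ᵢ J)

  intervalMaximal-absorbs : IsIntervalMaximalΔClique C J → IsΔClique G Δ C L →
                            + Δ ≤ ∣ J ∩ᵢ L ∣ᵢ → L ⊆ᵢ J
  intervalMaximal-absorbs {J = J} {L} (cliqueJ , maxJ) cliqueL ov =
    ⊆ᵢ-trans (∪ᵢ-upperʳ J L)
      (maxJ (J ∪ᵢ L) (∪ᵢ-upperˡ J L) (IsΔClique-∪ᵢ {J} {L} ov cliqueJ cliqueL))

  intervalMaximal⇒timeMaximal : IsIntervalMaximalΔClique C I → IsTimeMaximalΔClique G Δ C I
  intervalMaximal⇒timeMaximal (cliqueI , maxI) = cliqueI , λ where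
    (C′ , I′ , cliqueI′ , (I⊆I′ , I≢I′) , C⊆C′) →
      I≢I′ (⊆ᵢ-antisym I⊆I′ (maxI I′ I⊆I′ (IsΔClique-⊆ C⊆C′ cliqueI′)))

  intervalMaximal-T : + Δ ≤ ∣ T G ∣ᵢ → (∀ x y → C x → C y → x ≡ y) →
                      IsIntervalMaximalΔClique C (T G)
  intervalMaximal-T long subsingleton =
    (long , ⊆ᵢ-refl , λ x y cx cy x≢y → ⊥-elim (x≢y (subsingleton x y cx cy))) ,
    λ { L _ (_ , L⊆T , _) → L⊆T }

  Candidates : VISet G Δ → VSet G Δ → Set
  Candidates P C = ∀ w J → P (w , J) → IsIntervalMaximalΔClique (C ∷ᶜ w) J

  candidates-⊓Δ : Candidates P C → IsIntervalMaximalΔClique (C ∷ᶜ v) I →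
                  Candidates (_⊓Δ_ G Δ P (NΔ G Δ v I)) (C ∷ᶜ v)
  candidates-⊓Δ {P} {C} {v} {I} candP maximalI@(cliqueI , _) w _
    (J , K , PwJ , (K⊆I , (longK , covK) , maxK) , refl , ov) =
    IsΔClique-∷ᶜ-∷ᶜ (IsΔClique-⊆ᵢ ov (⊆ᵢ-trans (∩ᵢ-lowerʳ J K) K⊆I) cliqueI)
                    (IsΔClique-⊆ᵢ ov (∩ᵢ-lowerˡ J K) cliqueJ)
                    (Covered-⊆ᵢ (∩ᵢ-lowerʳ J K) covK) ,
    λ L J∩K⊆L cliqueL → ∩ᵢ-greatest (L⊆J cliqueL J∩K⊆L) (L⊆K cliqueL J∩K⊆L)
    where
    maximalJ = candP w J PwJ
    cliqueJ = proj₁ maximalJ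

    v≢w : v ≢ w
    v≢w refl = ¬Covered-self {K} longK covK

    module _ {L} (cliqueL : IsΔClique G Δ ((C ∷ᶜ v) ∷ᶜ w) L) (J∩K⊆L : (J ∩ᵢ K) ⊆ᵢ L) where
      L⊆J : L ⊆ᵢ J
      L⊆J = intervalMaximal-absorbs maximalJ
        (IsΔClique-⊆ (λ { _ (inj₁ c) → inj₁ (inj₁ c) ; _ (inj₂ e) → inj₂ e }) cliqueL)
        (long-∩ᵢ J L ov (∩ᵢ-lowerˡ J K) J∩K⊆L)

      L⊆I : L ⊆ᵢ I
      L⊆I = intervalMaximal-absorbs maximalI (IsΔClique-⊆ (λ _ → inj₁) cliqueL)
        (long-∩ᵢ I L ov (⊆ᵢ-trans (∩ᵢ-lowerʳ J K) K⊆I) J∩K⊆L)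

      L⊆K : L ⊆ᵢ K
      L⊆K = ⊆ᵢ-trans (∪ᵢ-upperˡ L K) (maxK (L ∪ᵢ K) (∪ᵢ-upperʳ L K) (∪ᵢ-least L⊆I K⊆I)
        (≤-trans longK (∣∣ᵢ-mono-⊆ᵢ (∪ᵢ-upperʳ L K)) ,
         Covered-∪ᵢ {L} {K} (long-∩ᵢ L K ov J∩K⊆L (∩ᵢ-lowerʳ J K))
           (proj₂ (proj₂ cliqueL) v w (inj₁ (inj₂ refl)) (inj₂ refl) v≢w) covK))

  candidates : + Δ ≤ ∣ T G ∣ᵢ → Call G Δ P C I X → Candidates P C
  candidates long initial w _ refl = intervalMaximal-T long λ where
    _ _ (inj₂ refl) (inj₂ refl) → refl
  candidates long (recurse call _ _ v I Pv _) =
    candidates-⊓Δ (λ w J → candP w J ∘ proj₁) (candP v I Pv)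
    where
    candP = candidates long call

  call-intervalMaximal : + Δ ≤ ∣ T G ∣ᵢ → Call G Δ P C I X → IsIntervalMaximalΔClique C I
  call-intervalMaximal long initial = intervalMaximal-T long λ _ _ ()
  call-intervalMaximal long (recurse call _ _ v I Pv _) = candidates long call v I Pv

lemma2 : (G : TemporalGraph) (Δ : ℕ) →
    + Δ ≤ ∣ T G ∣ᵢ →
    ∀ {P C I X} → Call G Δ P C I X → IsTimeMaximalΔClique G Δ C I
lemma2 G Δ long call = intervalMaximal⇒timeMaximal G Δ (call-intervalMaximal G Δ long call)
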